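{- Let $k\ge 1$ be an integer and let $G$ be a pure $(m,k)$-special graph with exactly $q$ $k$-clique constituents. Then $m = \left(\binom{k}{2}+2\right)q - 1$ and $\iota(G,\mathcal{F}_{\ell,k}) = q$ for each $\ell\in\{1,2,3\}$.
   Context: All graphs are finite and simple. For $X \subseteq V(G)$, $N_G[X]$ is the closed neighbourhood $\bigcup_{v\in X}(\{v\}\cup N_G(v))$. For a set $\mathcal{F}$ of graphs, a set $D \subseteq V(G)$ is $\mathcal{F}$-isolating if $G - N_G[D]$ (delete the vertices of $N_G[D]$) has no subgraph isomorphic to a member of $\mathcal{F}$; $\iota(G,\mathcal{F})$ is the minimum size of an $\mathcal{F}$-isolating set. $\mathcal{F}_{1,k}$ is the set of (nonempty) regular graphs of degree at least $k-1$; $\mathcal{F}_{2,k}$ is the set of graphs with chromatic number at least $k$; $\mathcal{F}_{3,k}=\mathcal{F}_{1,k}\cup\mathcal{F}_{2,k}$. $(m,k)$-special graphs: let $t_k=\binom{k}{2}+2$ and write $m+1 = q t_k + r$ with integers $q\ge 0$, $0\le r\le t_k-1$. If $q\ge1$, let $v_1,\dots,v_q$ be distinct vertices, let $U_1,\dots,U_q$ be pairwise disjoint $k$-element sets disjoint from $\{v_1,\dots,v_q\}$, and for each $i$ let $u_i^1\in U_i$ and let $G_i$ be the graph with vertex set $U_i\cup\{v_i\}$ and edge set $\binom{U_i}{2}\cup\{u_i^1v_i\}$. A graph $G$ is an $(m,k)$-special graph if either $q=0$ and $G$ is a tree with $r$ edges, or $q\ge 1$ and $G$ has vertex set $V(T')\cup\bigcup_{i=1}^q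 V(G_i)$ and edge set $E(T)\cup E(T')\cup\bigcup_{i=1}^q E(G_i)$, where $T$ is a tree with vertex set $\{v_1,\dots,v_q\}$ and $T'$ is a tree with $r$ edges such that $V(T')\cap\bigcup_{i=1}^q V(G_i)=\{v_q\}$. The graphs $G_1,\dots,G_q$ are the $k$-clique constituents of $G$. $G$ is pure if $r=0$. -}

module Defs where

open import Data.Nat using (ℕ; zero; suc; _+_; _*_; _∸_; _≤_; _<_; _<ᵇ_)
open import Data.Nat.Combinatorics using (_C_)
open import Data.Bool using (Bool; true; false; if_then_else_; _∧_)
open import Data.Fin using (Fin; zero; suc; toℕ; inject₁; fromℕ)
open import Data.Fin.Subset using (Subset; _∈_; _∉_; ∣_∣)
open import Data.Product using (Σ; ∃; ∃-syntax; _×_; _,_)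
open import Data.Sum using (_⊎_)
open import Relation.Binary.PropositionalEquality using (_≡_; _≢_)
open import Relation.Nullary using (¬_)
open import Function.Bundles using (_⇔_)

record Graph (n : ℕ) : Set where
  field
    Adj    : Fin n → Fin n → Bool
    sym    : ∀ x y → Adj x y ≡ Adj y x
    irrefl : ∀ x → Adj x x ≡ false
open Graph public

_∼[_]_ : ∀ {n} → Fin n → Graph n → Fin n → Set
x ∼[ G ] y = Adj G x y ≡ true

Injective : ∀ {a b} → (Fin a → Fin b) → Set
Injective f = ∀ x y → f x ≡ f y → x ≡ y

sumF : ∀ {n} → (Fin n → ℕ) → ℕ
sumF {zero}  f = 0
sumF {suc n} f = f zero + sumF (λ i → f (suc i))

count : ∀ {n} → (Fin n → Bool) → ℕ
count p = sumF (λ i → if p i then 1 else 0)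

degree : ∀ {n} → Graph n → Fin n → ℕ
degree G v = count (Adj G v)

numEdges : ∀ {n} → Graph n → ℕ
numEdges G = sumF (λ x → count (λ y → (toℕ x <ᵇ toℕ y) ∧ Adj G x y))

data Walk {n} (G : Graph n) : Fin n → Fin n → Set where
  here : ∀ {x} → Walk G x x
  step : ∀ {x y z} → x ∼[ G ] y → Walk G y z → Walk G x z

Connected : ∀ {n} → Graph n → Set
Connected G = ∀ x y → Walk G x y

-- a cycle of length 3 + l : distinct vertices c 0, …, c (2+l) with
-- consecutive ones adjacent and c (2+l) adjacent to c 0
IsCycle : ∀ {n} → Graph n → (l : ℕ) → (Fin (3 + l) → Fin n) → Set
IsCycle G l c =
  Injective c ×
  (∀ (i : Fin (2 + l)) → c (inject₁ i) ∼[ G ] c (suc i)) ×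
  (c (fromℕ (2 + l)) ∼[ G ] c zero)

Acyclic : ∀ {n} → Graph n → Set
Acyclic G = ∀ l c → ¬ IsCycle G l c

IsTree : ∀ {n} → Graph n → Set
IsTree {n} G = (1 ≤ n) × Connected G × Acyclic G

InClosedNbhd : ∀ {n} → Graph n → Subset n → Fin n → Set
InClosedNbhd G D x = ∃[ u ] (u ∈ D × (u ≡ x ⊎ u ∼[ G ] x))

-- G - N_G[D] has a subgraph isomorphic to H
HasCopyOutside : ∀ {n h} → Graph n → Subset n → Graph h → Set
HasCopyOutside {n} {h} G D H =
  Σ (Fin h → Fin n) λ f →
    Injective f ×
    (∀ a → ¬ InClosedNbhd G D (f a)) ×
    (∀ a b → a ∼[ H ] b → f a ∼[ G ] f b)

Family : Set₁
Family = (h : ℕ) → Graph h → Set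

Isolating : ∀ {n} → Graph n → Family → Subset n → Set
Isolating G 𝓕 D = ∀ h (H : Graph h) → 𝓕 h H → ¬ HasCopyOutside G D H

IotaIs : ∀ {n} → Graph n → Family → ℕ → Set
IotaIs {n} G 𝓕 i =
  (Σ (Subset n) λ D → Isolating G 𝓕 D × ∣ D ∣ ≡ i) ×
  (∀ (D : Subset n) → Isolating G 𝓕 D → i ≤ ∣ D ∣)

𝓕₁ : ℕ → Family
𝓕₁ k h H = (1 ≤ h) × ∃[ d ] ((k ∸ 1 ≤ d) × (∀ v → degree H v ≡ d))

ProperColouring : ∀ {h} → Graph h → (c : ℕ) → (Fin h → Fin c) → Set
ProperColouring H c col = ∀ a b → a ∼[ H ] b → col a ≢ col b

ChromaticAtLeast : ∀ {h} → Graph h → ℕ → Set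
ChromaticAtLeast {h} H k =
  ∀ c → c < k → ¬ (Σ (Fin h → Fin c) λ col → ProperColouring H c col)

𝓕₂ : ℕ → Family
𝓕₂ k h H = ChromaticAtLeast H k

𝓕₃ : ℕ → Family
𝓕₃ k h H = 𝓕₁ k h H ⊎ 𝓕₂ k h H

t : ℕ → ℕ
t k = k C 2 + 2

-- The structure in the case q = suc q' ≥ 1 (vertices v_1..v_q are
-- v zero .. v (fromℕ q'), so v_q = v (fromℕ q')).
record CliqueStructure {n} (k : ℕ) (G : Graph n) (q' r : ℕ) : Set where
  field
    v   : Fin (suc q') → Fin n
    U   : Fin (suc q') → Fin k → Fin n          -- U_i = image of U i
    u1  : Fin (suc q') → Fin k                  -- u_i^1 = U i (u1 i)
    v-inj  : Injective v
    U-inj  : ∀ i j a b → U i a ≡ U j b → (i ≡ j × a ≡ b)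
    vU-disj : ∀ i j a → v i ≢ U j a
    T      : Graph (suc q')
    T-tree : IsTree T
    p       : ℕ
    T′      : Graph p
    T′-tree : IsTree T′
    T′-edges : numEdges T′ ≡ r
    w       : Fin p → Fin n
    w-inj   : Injective w
    -- V(T') ∩ ⋃ V(G_i) = {v_q}
    meet-v  : ∀ a i → w a ≡ v i → i ≡ fromℕ q'
    meet-U  : ∀ a i b → w a ≢ U i b
    meet-vq : ∃[ a ] (w a ≡ v (fromℕ q'))
    cover : ∀ x → (∃[ a ] (w a ≡ x)) ⊎ (∃[ i ] (v i ≡ x)) ⊎ (∃[ i ] ∃[ a ] (U i a ≡ x))
    edges : ∀ x y → x ∼[ G ] y ⇔
      ((∃[ i ] ∃[ j ] (v i ≡ x × v j ≡ y × i ∼[ T ] j))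
       ⊎ (∃[ a ] ∃[ b ] (w a ≡ x × w b ≡ y × a ∼[ T′ ] b))
       ⊎ (∃[ i ] ∃[ a ] ∃[ b ] (U i a ≡ x × U i b ≡ y × a ≢ b))
       ⊎ (∃[ i ] ((U i (u1 i) ≡ x × v i ≡ y) ⊎ (v i ≡ x × U i (u1 i) ≡ y))))

data Special {n} (m k : ℕ) (G : Graph n) : ℕ → ℕ → Set where
  tree-case   : ∀ {r} → suc m ≡ r → r < t k →
                IsTree G → numEdges G ≡ r → Special m k G 0 r
  clique-case : ∀ {q' r} → suc m ≡ suc q' * t k + r → r < t k →
                CliqueStructure k G q' r → Special m k G (suc q') r

PureSpecial : ∀ {n} → ℕ → ℕ → Graph n → ℕ → Set
PureSpecial m k G q = Special m k G q 0

-- Since r = 0 the tree T′ is the single vertex v_q, so G is the tree T on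
-- v_1, …, v_q with a k-clique U_i hanging from each v_i by the edge v_i u_i¹.
-- Lower bound: each U_i induces K_k, which lies in every 𝓕_ℓ,k, so an isolating
-- set must dominate a vertex of U_i; only vertices of G_i do, and the G_i are
-- disjoint. Upper bound: G - N[{v_1, …, v_q}] is the disjoint union of the
-- cliques U_i - u_i¹ on k - 1 vertices, so every subgraph of it is properly
-- (k-1)-coloured by position in its clique, and in it every vertex has fewer
-- than k - 1 neighbours.
module Submission where

open import Defs hiding (sym)
open import Data.Bool using (Bool; true; false; not; _∧_; if_then_else_)
open import Data.Bool.Properties using (T-≡) renaming (_≟_ to _≟ᵇ_)
open import Data.Fin using (Fin; zero; suc; toℕ; fromℕ; fromℕ<; punchOut)
open import Data.Fin.Properties
  using (_≟_; any?; 0≢1+n; suc-injective; toℕ-injective; punchOut-injective; pigeonhole)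
  renaming (<⇒≢ to <⇒≢ᶠ)
open import Data.Fin.Subset using (Subset; _∈_; ∣_∣; ⊥; ⁅_⁆; _∪_; _-_)
open import Data.Fin.Subset.Properties
  using (_∈?_; x∈⁅x⁆; ∣⁅x⁆∣≡1; ∣⊥∣≡0; x∈p∪q⁺; x∈p∧x≢y⇒x∈p-y; x∈p⇒∣p-x∣<∣p∣)
open import Data.Nat using (ℕ; zero; suc; _+_; _*_; _∸_; _≤_; _<_; _<ᵇ_; z≤n; s≤s)
open import Data.Nat.Properties
  using (≤-refl; ≤-reflexive; ≤-trans; ≤-antisym; ≤⇒≯; <-cmp; <⇒<ᵇ; n≤1+n;
         +-suc; +-identityʳ; *-comm; +-mono-≤; +-monoʳ-≤; m+n≡0⇒m≡0; m+n≡0⇒n≡0)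
open import Data.Product using (∃-syntax; _×_; _,_; proj₁; proj₂)
open import Data.Sum using (_⊎_; inj₁; inj₂; [_,_]′)
open import Data.Vec using ([]; _∷_)
open import Function using (_∘_; id)
open import Function.Bundles using (Equivalence)
open import Relation.Binary using (tri<; tri≈; tri>)
open import Relation.Binary.PropositionalEquality
  using (_≡_; _≢_; refl; sym; trans; cong; cong₂; subst; module ≡-Reasoning)
open import Relation.Nullary using (¬_; Dec; yes; no; does; contradiction)
open import Relation.Nullary.Decidable using (dec-true; dec-false; _×-dec_; _⊎-dec_)

open Equivalence using (to; from)

count-≤-injection : ∀ {n m} (p : Fin n → Bool) (g : ∀ x → p x ≡ true → Fin m) →
  (∀ x y px py → g x px ≡ g y py → x ≡ y) → count p ≤ m
count-≤-injection {zero} p g g-inj = z≤n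
count-≤-injection {suc n} p g g-inj with p zero in p₀
... | false = count-≤-injection (p ∘ suc) (λ x → g (suc x))
                (λ x y px py e → suc-injective (g-inj _ _ px py e))
count-≤-injection {suc n} {zero} p g g-inj | true with g zero p₀
... | ()
count-≤-injection {suc n} {suc m} p g g-inj | true =
  s≤s (count-≤-injection (p ∘ suc) (λ x px → punchOut (g₀≢ x px))
         (λ x y px py e → suc-injective
            (g-inj _ _ px py (punchOut-injective (g₀≢ x px) (g₀≢ y py) e))))
  where
  g₀≢ : ∀ x px → g zero p₀ ≢ g (suc x) px
  g₀≢ x px e = 0≢1+n (g-inj zero (suc x) p₀ px e)

injection-≤-∣∣ : ∀ {q n} (D : Subset n) (f : Fin q → Fin n) →
  Injective f → (∀ i → f i ∈ D) → q ≤ ∣ D ∣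
injection-≤-∣∣ {zero} D f f-inj f∈D = z≤n
injection-≤-∣∣ {suc q} D f f-inj f∈D =
  ≤-trans (s≤s (injection-≤-∣∣ (D - f zero) (f ∘ suc)
                  (λ i j e → suc-injective (f-inj _ _ e))
                  (λ i → x∈p∧x≢y⇒x∈p-y (f∈D (suc i)) (0≢1+n ∘ sym ∘ f-inj _ _))))
          (x∈p⇒∣p-x∣<∣p∣ (f∈D zero))

∣p∪q∣≤∣p∣+∣q∣ : ∀ {n} (p q : Subset n) → ∣ p ∪ q ∣ ≤ ∣ p ∣ + ∣ q ∣
∣p∪q∣≤∣p∣+∣q∣ [] [] = z≤n
∣p∪q∣≤∣p∣+∣q∣ (true ∷ p) (true ∷ q) =
  s≤s (≤-trans (∣p∪q∣≤∣p∣+∣q∣ p q) (+-monoʳ-≤ ∣ p ∣ (n≤1+n ∣ q ∣)))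
∣p∪q∣≤∣p∣+∣q∣ (true ∷ p) (false ∷ q) = s≤s (∣p∪q∣≤∣p∣+∣q∣ p q)
∣p∪q∣≤∣p∣+∣q∣ (false ∷ p) (true ∷ q) =
  ≤-trans (s≤s (∣p∪q∣≤∣p∣+∣q∣ p q)) (≤-reflexive (sym (+-suc ∣ p ∣ ∣ q ∣)))
∣p∪q∣≤∣p∣+∣q∣ (false ∷ p) (false ∷ q) = ∣p∪q∣≤∣p∣+∣q∣ p q

image : ∀ {q n} → (Fin q → Fin n) → Subset n
image {zero}  f = ⊥
image {suc q} f = ⁅ f zero ⁆ ∪ image (f ∘ suc)

∈-image : ∀ {q n} (f : Fin q → Fin n) i → f i ∈ image f
∈-image f zero    = x∈p∪q⁺ (inj₁ (x∈⁅x⁆ (f zero)))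
∈-image f (suc i) = x∈p∪q⁺ (inj₂ (∈-image (f ∘ suc) i))

∣image∣≤ : ∀ {q n} (f : Fin q → Fin n) → ∣ image f ∣ ≤ q
∣image∣≤ {zero} {n} f = ≤-reflexive (∣⊥∣≡0 n)
∣image∣≤ {suc q} f =
  ≤-trans (∣p∪q∣≤∣p∣+∣q∣ ⁅ f zero ⁆ (image (f ∘ suc)))
          (+-mono-≤ (≤-reflexive (∣⁅x⁆∣≡1 (f zero))) (∣image∣≤ (f ∘ suc)))

∼⇒≢ : ∀ {n} (G : Graph n) {x y} → x ∼[ G ] y → x ≢ y
∼⇒≢ G x∼y refl = contradiction (trans (sym (irrefl G _)) x∼y) λ ()

sumF≡0⇒≡0 : ∀ {n} (f : Fin n → ℕ) → sumF f ≡ 0 → ∀ x → f x ≡ 0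
sumF≡0⇒≡0 f e zero    = m+n≡0⇒m≡0 (f zero) e
sumF≡0⇒≡0 f e (suc x) = sumF≡0⇒≡0 (f ∘ suc) (m+n≡0⇒n≡0 (f zero) e) x

numEdges≡0⇒¬∼-ordered : ∀ {n} (G : Graph n) → numEdges G ≡ 0 →
  ∀ x y → toℕ x < toℕ y → ¬ (x ∼[ G ] y)
numEdges≡0⇒¬∼-ordered G no-edges x y x<y x∼y =
  contradiction (sumF≡0⇒≡0 _ (sumF≡0⇒≡0 _ no-edges x) y)
                (subst (λ e → (if e then 1 else 0) ≢ 0) (sym counted) λ ())
  where
  counted : ((toℕ x <ᵇ toℕ y) ∧ Adj G x y) ≡ true
  counted = cong₂ _∧_ (to T-≡ (<⇒<ᵇ x<y)) x∼y

numEdges≡0⇒¬∼ : ∀ {n} (G : Graph n) → numEdges G ≡ 0 → ∀ x y → ¬ (x ∼[ G ] y)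
numEdges≡0⇒¬∼ G no-edges x y x∼y with <-cmp (toℕ x) (toℕ y)
... | tri< x<y _ _ = numEdges≡0⇒¬∼-ordered G no-edges x y x<y x∼y
... | tri≈ _ x≡y _ = ∼⇒≢ G x∼y (toℕ-injective x≡y)
... | tri> _ _ y<x = numEdges≡0⇒¬∼-ordered G no-edges y x y<x (trans (Graph.sym G y x) x∼y)

connected-edgeless⇒≡ : ∀ {n} (G : Graph n) → Connected G →
  (∀ x y → ¬ (x ∼[ G ] y)) → ∀ x y → x ≡ y
connected-edgeless⇒≡ G connected edgeless x y with connected x y
... | here       = refl
... | step x∼z _ = contradiction x∼z (edgeless _ _)

≟-sym : ∀ {k} (x y : Fin k) → does (x ≟ y) ≡ does (y ≟ x)
≟-sym x y with x ≟ y | y ≟ x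
... | yes _   | yes _   = refl
... | no _    | no _    = refl
... | yes x≡y | no y≢x  = contradiction (sym x≡y) y≢x
... | no x≢y  | yes y≡x = contradiction (sym y≡x) x≢y

complete : (k : ℕ) → Graph k
complete k = record
  { Adj    = λ x y → not (does (x ≟ y))
  ; sym    = λ x y → cong not (≟-sym x y)
  ; irrefl = λ x → cong not (dec-true (x ≟ x) refl)
  }

count-true : ∀ n → count {n} (λ _ → true) ≡ n
count-true zero    = refl
count-true (suc n) = cong suc (count-true n)

complete-degree : ∀ {k} (x : Fin (suc k)) → degree (complete (suc k)) x ≡ k
complete-degree {k}     zero    = count-true k
complete-degree {suc k} (suc x) = cong suc (complete-degree x)

complete∈𝓕₁ : ∀ k → 𝓕₁ (suc k) (suc k) (complete (suc k))
complete∈𝓕₁ k = s≤s z≤n , k , ≤-refl , complete-degree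

complete∈𝓕₂ : ∀ k → 𝓕₂ k k (complete k)
complete∈𝓕₂ k c c<k (col , proper) with pigeonhole c<k col
... | i , j , i<j , same = proper i j (cong not (dec-false (i ≟ j) (<⇒≢ᶠ i<j))) same

degree-<-colours : ∀ {h c} (H : Graph h) (col : Fin h → Fin c) → ProperColouring H c col →
  ∀ a → (∀ x y → a ∼[ H ] x → a ∼[ H ] y → col x ≡ col y → x ≡ y) → degree H a < c
degree-<-colours {c = zero} H col proper a nbrs-inj with col a
... | ()
degree-<-colours {c = suc c} H col proper a nbrs-inj =
  s≤s (count-≤-injection (Adj H a) (λ x a∼x → punchOut (proper a x a∼x))
         (λ x y a∼x a∼y e → nbrs-inj x y a∼x a∼y
            (punchOut-injective (proper a x a∼x) (proper a y a∼y) e)))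

punchOut-injective′ : ∀ {m} {i i′ j j′ : Fin (suc m)} (i≢j : i ≢ j) (i′≢j′ : i′ ≢ j′) →
  i ≡ i′ → punchOut i≢j ≡ punchOut i′≢j′ → j ≡ j′
punchOut-injective′ i≢j i′≢j′ refl = punchOut-injective i≢j i′≢j′

inClosedNbhd? : ∀ {n} (G : Graph n) (D : Subset n) x → Dec (InClosedNbhd G D x)
inClosedNbhd? G D x = any? (λ u → (u ∈? D) ×-dec ((u ≟ x) ⊎-dec (Adj G u x ≟ᵇ true)))

isolating⇒copy-meets-closedNbhd : ∀ {n h} (G : Graph n) {𝓕 : Family} {D : Subset n}
  {H : Graph h} → Isolating G 𝓕 D → 𝓕 h H → (f : Fin h → Fin n) → Injective f →
  (∀ a b → a ∼[ H ] b → f a ∼[ G ] f b) → ∃[ a ] InClosedNbhd G D (f a)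
isolating⇒copy-meets-closedNbhd G {D = D} {H} isolating H∈𝓕 f f-inj f-hom
  with any? (λ a → inClosedNbhd? G D (f a))
... | yes met = met
... | no ¬met = contradiction (f , f-inj , (λ a a∈N → ¬met (a , a∈N)) , f-hom)
                             (isolating _ H H∈𝓕)

isolating-⊆ : ∀ {n} (G : Graph n) {𝓕 𝓖 : Family} {D : Subset n} →
  (∀ {h H} → 𝓕 h H → 𝓖 h H) → Isolating G 𝓖 D → Isolating G 𝓕 D
isolating-⊆ G 𝓕⊆𝓖 isolating h H H∈𝓕 = isolating h H (𝓕⊆𝓖 H∈𝓕)

module PureCliqueStructure {n k′ q′} {G : Graph n} (cs : CliqueStructure (suc k′) G q′ 0) where
  open CliqueStructure cs

  private
    k q : ℕ
    k = suc k′
    q = suc q′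

  T′-edgeless : ∀ a b → ¬ (a ∼[ T′ ] b)
  T′-edgeless = numEdges≡0⇒¬∼ T′ T′-edges

  w≡v-last : ∀ a → w a ≡ v (fromℕ q′)
  w≡v-last a with meet-vq
  ... | a₀ , wa₀≡ =
    trans (cong w (connected-edgeless⇒≡ T′ (proj₁ (proj₂ T′-tree)) T′-edgeless a a₀)) wa₀≡

  vertex-cases : ∀ x → (∃[ i ] (v i ≡ x)) ⊎ (∃[ i ] ∃[ b ] (U i b ≡ x))
  vertex-cases x with cover x
  ... | inj₁ (a , wa≡x) = inj₁ (fromℕ q′ , trans (sym (w≡v-last a)) wa≡x)
  ... | inj₂ other      = other

  U-neighbour : ∀ {i b y} → U i b ∼[ G ] y →
    (∃[ b′ ] (U i b′ ≡ y × b ≢ b′)) ⊎ (b ≡ u1 i × v i ≡ y)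
  U-neighbour {i} {b} {y} adj with to (edges (U i b) y) adj
  ... | inj₁ (j , _ , vj≡ , _) = contradiction vj≡ (vU-disj j i b)
  ... | inj₂ (inj₁ (a , c , _ , _ , a∼c)) = contradiction a∼c (T′-edgeless a c)
  ... | inj₂ (inj₂ (inj₁ (j , a , c , Uja≡ , Ujc≡ , a≢c))) with U-inj j i a b Uja≡
  ...   | refl , refl = inj₁ (c , Ujc≡ , a≢c)
  U-neighbour {i} {b} {y} adj | inj₂ (inj₂ (inj₂ (j , inj₁ (Uju≡ , vj≡))))
    with U-inj j i (u1 j) b Uju≡
  ...   | refl , refl = inj₂ (refl , vj≡)
  U-neighbour {i} {b} {y} adj | inj₂ (inj₂ (inj₂ (j , inj₂ (vj≡ , _)))) =
    contradiction vj≡ (vU-disj j i b)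

  v∼u1 : ∀ i → v i ∼[ G ] U i (u1 i)
  v∼u1 i = from (edges _ _) (inj₂ (inj₂ (inj₂ (i , inj₂ (refl , refl)))))

  U∼U : ∀ i {a b} → a ≢ b → U i a ∼[ G ] U i b
  U∼U i a≢b = from (edges _ _) (inj₂ (inj₂ (inj₁ (i , _ , _ , refl , refl , a≢b))))

  InConstituent : Fin n → Fin q → Set
  InConstituent x i = (v i ≡ x) ⊎ (∃[ b ] (U i b ≡ x))

  constituent-unique : ∀ {x i j} → InConstituent x i → InConstituent x j → i ≡ j
  constituent-unique (inj₁ vi≡) (inj₁ vj≡) = v-inj _ _ (trans vi≡ (sym vj≡))
  constituent-unique (inj₁ vi≡) (inj₂ (b , Ujb≡)) =
    contradiction (trans vi≡ (sym Ujb≡)) (vU-disj _ _ b)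
  constituent-unique (inj₂ (b , Uib≡)) (inj₁ vj≡) =
    contradiction (trans vj≡ (sym Uib≡)) (vU-disj _ _ b)
  constituent-unique (inj₂ (b , Uib≡)) (inj₂ (c , Ujc≡)) =
    proj₁ (U-inj _ _ b c (trans Uib≡ (sym Ujc≡)))

  dominator-in-constituent : ∀ {u i b} → (u ≡ U i b) ⊎ (u ∼[ G ] U i b) → InConstituent u i
  dominator-in-constituent {b = b} (inj₁ u≡) = inj₂ (b , sym u≡)
  dominator-in-constituent (inj₂ u∼) with U-neighbour (trans (Graph.sym G _ _) u∼)
  ... | inj₁ (b′ , Ub′≡u , _) = inj₂ (b′ , Ub′≡u)
  ... | inj₂ (_ , vi≡u)       = inj₁ vi≡u

  isolating-≥ : ∀ {𝓕 : Family} {D : Subset n} →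
    𝓕 k (complete k) → Isolating G 𝓕 D → q ≤ ∣ D ∣
  isolating-≥ {D = D} K∈𝓕 isolating =
    injection-≤-∣∣ D (proj₁ ∘ dominator) dominator-injective (proj₁ ∘ proj₂ ∘ dominator)
    where
    dominator : ∀ i → ∃[ u ] (u ∈ D × InConstituent u i)
    dominator i with isolating⇒copy-meets-closedNbhd G isolating K∈𝓕 (U i)
                       (λ a b e → proj₂ (U-inj i i a b e))
                       (λ a b a∼b → U∼U i (∼⇒≢ (complete k) a∼b))
    ... | _ , u , u∈D , dominates = u , u∈D , dominator-in-constituent dominates

    dominator-injective : Injective (proj₁ ∘ dominator)
    dominator-injective i j same = constituent-unique
      (subst (λ x → InConstituent x i) same (proj₂ (proj₂ (dominator i))))
      (proj₂ (proj₂ (dominator j)))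

  D₀ : Subset n
  D₀ = image v

  outside-N[D₀] : ∀ {x} → ¬ InClosedNbhd G D₀ x → ∃[ i ] ∃[ b ] (U i b ≡ x × u1 i ≢ b)
  outside-N[D₀] {x} x∉N with vertex-cases x
  ... | inj₁ (i , refl) = contradiction (v i , ∈-image v i , inj₁ refl) x∉N
  ... | inj₂ (i , b , refl) with u1 i ≟ b
  ...   | yes refl  = contradiction (v i , ∈-image v i , inj₂ (v∼u1 i)) x∉N
  ...   | no u1≢b   = i , b , refl , u1≢b

  module CopyOutsideN[D₀] {h} (H : Graph h) (f : Fin h → Fin n) (f-inj : Injective f)
                          (f-out : ∀ a → ¬ InClosedNbhd G D₀ (f a))
                          (f-hom : ∀ a b → a ∼[ H ] b → f a ∼[ G ] f b) where

    clique : Fin h → Fin q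
    clique a = proj₁ (outside-N[D₀] (f-out a))

    position : Fin h → Fin k
    position a = proj₁ (proj₂ (outside-N[D₀] (f-out a)))

    U-position : ∀ a → U (clique a) (position a) ≡ f a
    U-position a = proj₁ (proj₂ (proj₂ (outside-N[D₀] (f-out a))))

    u1≢position : ∀ a → u1 (clique a) ≢ position a
    u1≢position a = proj₂ (proj₂ (proj₂ (outside-N[D₀] (f-out a))))

    colour : Fin h → Fin k′
    colour a = punchOut (u1≢position a)

    ∼⇒same-clique : ∀ {a b} → a ∼[ H ] b → clique a ≡ clique b
    ∼⇒same-clique {a} {b} a∼b
      with U-neighbour (subst (_∼[ G ] f b) (sym (U-position a)) (f-hom a b a∼b))
    ... | inj₁ (b′ , Ub′≡fb , _) = proj₁ (U-inj _ _ b′ _ (trans Ub′≡fb (sym (U-position b))))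
    ... | inj₂ (position≡u1 , _) = contradiction (sym position≡u1) (u1≢position a)

    same-clique-colour⇒≡ : ∀ a b → clique a ≡ clique b → colour a ≡ colour b → a ≡ b
    same-clique-colour⇒≡ a b same-clique same-colour = f-inj a b (begin
      f a                             ≡⟨ sym (U-position a) ⟩
      U (clique a) (position a)       ≡⟨ cong₂ U same-clique same-position ⟩
      U (clique b) (position b)       ≡⟨ U-position b ⟩
      f b                             ∎)
      where
      open ≡-Reasoning
      same-position : position a ≡ position b
      same-position = punchOut-injective′ (u1≢position a) (u1≢position b)
                        (cong u1 same-clique) same-colour

    colour-proper : ProperColouring H k′ colour
    colour-proper a b a∼b same =
      ∼⇒≢ H a∼b (same-clique-colour⇒≡ a b (∼⇒same-clique a∼b) same)

    ∉𝓕₂ : ¬ 𝓕₂ k h H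
    ∉𝓕₂ χ≥k = χ≥k k′ ≤-refl (colour , colour-proper)

    ∉𝓕₁ : ¬ 𝓕₁ k h H
    ∉𝓕₁ (h≥1 , d , k′≤d , regular) =
      ≤⇒≯ k′≤d (subst (_< k′) (regular a₀)
        (degree-<-colours H colour colour-proper a₀ λ x y a₀∼x a₀∼y →
          same-clique-colour⇒≡ x y (trans (sym (∼⇒same-clique a₀∼x)) (∼⇒same-clique a₀∼y))))
      where
      a₀ : Fin h
      a₀ = fromℕ< h≥1

  D₀-isolating : Isolating G (𝓕₃ k) D₀
  D₀-isolating h H H∈𝓕₃ (f , f-inj , f-out , f-hom) = [ ∉𝓕₁ , ∉𝓕₂ ]′ H∈𝓕₃
    where open CopyOutsideN[D₀] H f f-inj f-out f-hom

  ι≡q : ∀ {𝓕 : Family} → (∀ {h H} → 𝓕 h H → 𝓕₃ k h H) →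
    𝓕 k (complete k) → IotaIs G 𝓕 q
  ι≡q {𝓕} 𝓕⊆𝓕₃ K∈𝓕 =
    (D₀ , D₀-isolating′ , ≤-antisym (∣image∣≤ v) (isolating-≥ K∈𝓕 D₀-isolating′)) ,
    λ D → isolating-≥ K∈𝓕
    where
    D₀-isolating′ : Isolating G 𝓕 D₀
    D₀-isolating′ = isolating-⊆ G 𝓕⊆𝓕₃ D₀-isolating

proposition2p3 : ∀ (k m q n : ℕ) (G : Graph n) → 1 ≤ k →
    PureSpecial m k G q →
    (m ≡ t k * q ∸ 1) ×
    IotaIs G (𝓕₁ k) q × IotaIs G (𝓕₂ k) q × IotaIs G (𝓕₃ k) q
proposition2p3 k m .0 n G _ (tree-case () _ _ _)
proposition2p3 (suc k′) m .(suc q′) n G (s≤s z≤n) (clique-case {q′} m+1≡ _ cs) =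
  m≡ ,
  ι≡q inj₁ (complete∈𝓕₁ k′) ,
  ι≡q inj₂ (complete∈𝓕₂ (suc k′)) ,
  ι≡q id (inj₁ (complete∈𝓕₁ k′))
  where
  open PureCliqueStructure cs
  m≡ : m ≡ t (suc k′) * suc q′ ∸ 1
  m≡ = cong (_∸ 1) (trans m+1≡ (trans (+-identityʳ _) (*-comm (suc q′) (t (suc k′)))))
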